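{- For every BCSL model $\mathcal{B} = (\mathcal{R}, \sigma_s, \sigma_a, \mathsf{M}_0)$ there exists a multiset rewriting system $\mathcal{M} = (\mathcal{X}, \mathsf{M}_0)$ (with the same initial multiset) such that $\mathfrak{L}(\mathtt{LTS}_\varepsilon(\mathcal{B})) = \mathfrak{L}(\mathcal{M})$, i.e. the set of infinite runs generated by the extended labelled transition system of $\mathcal{B}$ equals the set of runs of $\mathcal{M}$.
   Context: Fix mutually disjoint finite sets $\mathcal{V}_\delta$ (feature names), $\mathcal{V}_a$ (atomic names), $\mathcal{V}_s$ (structure names), $\mathcal{V}_c$ (compartments). BCSL multisets are finite terms of the grammar: multiset ::= $\emptyset$ | agent | multiset $+$ multiset; agent ::= chain $::$ $c$ with $c\in\mathcal{V}_c$; chain ::= component | chain $.$ component; component ::= atomic | structure; structure ::= $s(\text{composition})$ with $s \in \mathcal{V}_s$; composition ::= $\emptyset$ | atomic | composition $,$ atomic; atomic ::= $a\{f\}$ with $a\in\mathcal{V}_a$, $f\in\mathcal{V}_\delta$; an atomic name occurs at most once in a composition. Terms are identified up to the least congruence $\equiv$ making $+$ commutative with unit $\emptyset$, satisfying $\text{chain}.\text{component} \equiv \text{component}.\text{chain}$, and making $,$ in compositions commutative with unit $\emptyset$; so a BCSL multiset is a multiset of (congruence classes of) agents, and $\subseteq,\cup,\setminus$ are defined accordingly. An atomic signature is $\sigma_a:\mathcal{V}_a\to 2^{\mathcal{V}_\delta}$ (non-empty values); a structure signature is $\sigma_s:\mathcal{V}_s\to 2^{\mathcal{V}_a}$. A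 pattern is a term of the same grammar but with features from $\mathcal{V}_\delta\cup\{\varepsilon\}$ ($\varepsilon$ a special symbol different from every feature), with atomics in compositions sorted alphanumerically by name; patterns compared to multisets are treated as multisets up to $\equiv$. An instantiation $\mathcal{I}$ of a pattern $\mathsf{P}$ replaces the feature $\varepsilon$ of each atomic named $a$ by some $\delta\in\sigma_a(a)$; $\Gamma(\mathsf{P})$ is the finite set of all instantiations. The expansion $\langle\mathsf{P}\rangle$ extends each composition of each structure $s$ by atomics $a\{\varepsilon\}$ for all $a\in\sigma_s(s)$ not yet present, keeping alphanumerical order. The deatomisation $d(\mathsf{P})$ is the sequence of atomics of $\mathsf{P}$ in order of occurrence. Instantiations $\mathcal{I}(\mathsf{P})$, $\mathcal{I}(\mathsf{P}')$ with $d(\mathsf{P})=\mathsf{A}_1,\dots,\mathsf{A}_n$, $d(\mathsf{P}')=\mathsf{A}'_1,\dots,\mathsf{A}'_m$ are consistent if for all $i<\min(m,n)$, $\mathsf{A}_i=\mathsf{A}'_i$ implies $\mathcal{I}(\mathsf{A}_i)=\mathcal{I}(\mathsf{A}'_i)$. A BCSL rule is a pair of patterns $\mathsf{P}_l \Rightarrow \mathsf{P}_r$. A BCSL model is $\mathcal{B}=(\mathcal{R},\sigma_s,\sigma_a,\mathsf{M}_0)$ with $\mathcal{R}$ a finite set of BCSL rules and $\mathsf{M}_0$ a grounded initial multiset (all features in $\mathcal{V}_\delta$). BCSL rewriting: $\mathsf{M}+\mathsf{M}_l \xrightarrow{\mathsf{R}} \mathsf{M}+\mathsf{M}_r$ for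 $\mathsf{R}=\mathsf{P}_l\Rightarrow\mathsf{P}_r\in\mathcal{R}$ whenever there exist consistent instantiations $\mathcal{I}\langle\mathsf{P}_l\rangle\in\Gamma\langle\mathsf{P}_l\rangle$, $\mathcal{I}\langle\mathsf{P}_r\rangle\in\Gamma\langle\mathsf{P}_r\rangle$ with $\mathcal{I}\langle\mathsf{P}_l\rangle=\mathsf{M}_l$, $\mathcal{I}\langle\mathsf{P}_r\rangle=\mathsf{M}_r$. $\mathtt{LTS}(\mathcal{B})=(S,T,L)$ has as states the multisets reachable from $\mathsf{M}_0$ by rewriting, as transitions the rewriting steps, labelled by the applied rule; $\mathtt{LTS}_\varepsilon(\mathcal{B})$ additionally has a self-loop labelled $\varepsilon$ on each state without successors. $\mathfrak{L}(\mathtt{LTS}_\varepsilon(\mathcal{B}))$ is the set of infinite sequences $s_0 s_1 s_2\ldots$ with $s_0=\mathsf{M}_0$ and $(s_{i-1},s_i)\in T$ (including the added self-loops) for all $i\ge1$. A multiset over a finite set $\mathcal{S}$ is a function $\mathcal{S}\to\mathbb{N}$; a multiset rewriting rule is a pair $\mu=({}^\bullet\mu,\mu^\bullet)$ of multisets, enabled at $\mathtt{M}$ if ${}^\bullet\mu\subseteq\mathtt{M}$, and applying it gives $(\mathtt{M}\setminus{}^\bullet\mu)\cup\mu^\bullet$ (truncated difference, additive union). An MRS is $\mathcal{M}=(\mathcal{X},\mathtt{M}_0)$ with $\mathcal{X}$ a finite set of rules and $\mathtt{M}_0$ an initial multiset; there is implicitly an empty rule $\varepsilon=(\emptyset,\emptyset)$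 applicable only when no rule of $\mathcal{X}$ is enabled. A run is an infinite sequence $\mathtt{M}_0\mathtt{M}_1\mathtt{M}_2\ldots$ where each $\mathtt{M}_i$ is obtained from $\mathtt{M}_{i-1}$ by applying an enabled rule of $\mathcal{X}$ or the empty rule; $\mathfrak{L}(\mathcal{M})$ is the set of all runs. Multisets of MRS over grounded BCSL agents are identified with BCSL multisets. -}

module Defs where

open import Data.Nat using (ℕ; zero; suc; _≤_; _∸_; _+_)
open import Data.Fin as Fin using (Fin; _<_; _≟_)
open import Data.Fin.Subset using (Subset; _∈_; Nonempty)
open import Data.Bool using (Bool; true; false; if_then_else_)
open import Data.Maybe using (Maybe; just; nothing)
open import Data.List using (List; []; _∷_; _++_; map; concatMap; filter; allFin; replicate; zip; null)
open import Data.List.NonEmpty as L⁺ using (List⁺; toList)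
open import Data.List.Relation.Binary.Permutation.Homogeneous using (Permutation)
open import Data.List.Relation.Binary.Permutation.Propositional using (_↭_)
open import Data.List.Relation.Binary.Pointwise using (Pointwise)
open import Data.List.Relation.Unary.All using (All)
open import Data.List.Relation.Unary.Linked using (Linked)
open import Data.List.Relation.Unary.Unique.Propositional using (Unique)
open import Data.List.Membership.Propositional renaming (_∈_ to _∈ₗ_)
open import Data.Vec using (lookup)
open import Data.Product using (Σ; ∃; ∃-syntax; _×_; _,_)
open import Data.Sum using (_⊎_)
open import Data.Empty using (⊥)
open import Data.Unit using (⊤)
open import Relation.Nullary using (¬_)
open import Relation.Binary.PropositionalEquality using (_≡_)
open import Function.Bundles using (_⇔_)

-- Vocabularies: each finite set is Fin k; the alphanumerical order on
-- atomic names is the order of Fin.  (Types are disjoint automatically.)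
record Vocab : Set where
  field
    nδ na ns nc : ℕ

module BCSL (V : Vocab) where
  open Vocab V

  Feature = Fin nδ
  AName   = Fin na
  SName   = Fin ns
  Cmpt    = Fin nc

  -- pattern features: nothing = ε
  PFeature = Maybe Feature

  record Atomic (F : Set) : Set where
    constructor atomic
    field
      name : AName
      feat : F
  open Atomic public

  data Component (F : Set) : Set where
    atom   : Atomic F → Component F
    struct : SName → List (Atomic F) → Component F

  record Agent (F : Set) : Set where
    constructor agent
    field
      chain       : List⁺ (Component F)
      compartment : Cmpt
  open Agent public

  -- a BCSL (multi)set term:  ∅ = [], + = _++_
  MSet : Set → Set
  MSet F = List (Agent F)

  Multiset = MSet Feature
  Pattern  = MSet PFeature

  UniqueComp : ∀ {F} → Component F → Set
  UniqueComp (atom _)      = ⊤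
  UniqueComp (struct _ xs) = Unique (map name xs)

  WFMultiset : Multiset → Set
  WFMultiset M = All (λ A → All UniqueComp (toList (chain A))) M

  SortedComp : Component PFeature → Set
  SortedComp (atom _)      = ⊤
  SortedComp (struct _ xs) = Linked (λ x y → name x < name y) xs

  WFPattern : Pattern → Set
  WFPattern P = All (λ A → All SortedComp (toList (chain A))) P

  -- the congruence ≡ (commutativity of + , of . in chains, of , in compositions)
  _≈c_ : ∀ {F} → Component F → Component F → Set
  atom x      ≈c atom y      = x ≡ y
  struct s xs ≈c struct t ys = s ≡ t × xs ↭ ys
  _           ≈c _           = ⊥

  _≈ag_ : ∀ {F} → Agent F → Agent F → Set
  A ≈ag B = Permutation _≈c_ (toList (chain A)) (toList (chain B))
          × compartment A ≡ compartment B

  infix 4 _≈ₘ_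
  _≈ₘ_ : ∀ {F} → MSet F → MSet F → Set
  _≈ₘ_ = Permutation _≈ag_

  AtomicSig = AName → Subset nδ
  StructSig = SName → Subset na

  module _ (σa : AtomicSig) where
    InstAtom : Atomic PFeature → Atomic Feature → Set
    InstAtom p g = name p ≡ name g
                 × (feat p ≡ just (feat g) ⊎ (feat p ≡ nothing × feat g ∈ σa (name g)))

    InstComp : Component PFeature → Component Feature → Set
    InstComp (atom p)      (atom g)      = InstAtom p g
    InstComp (struct s ps) (struct t gs) = s ≡ t × Pointwise InstAtom ps gs
    InstComp _             _             = ⊥

    InstAgent : Agent PFeature → Agent Feature → Set
    InstAgent P G = Pointwise InstComp (toList (chain P)) (toList (chain G))
                  × compartment P ≡ compartment G

    Inst : Pattern → Multiset → Set
    Inst = Pointwise InstAgent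

  module _ (σs : StructSig) where
    expandComp : SName → List (Atomic PFeature) → List (Atomic PFeature)
    expandComp s xs = concatMap pick (allFin na)
      where
        pick : AName → List (Atomic PFeature)
        pick a with filter (λ x → name x ≟ a) xs
        ... | [] = if lookup (σs s) a then atomic a nothing ∷ [] else []
        ... | ys = ys

    expandComponent : Component PFeature → Component PFeature
    expandComponent (atom x)      = atom x
    expandComponent (struct s xs) = struct s (expandComp s xs)

    expandAgent : Agent PFeature → Agent PFeature
    expandAgent (agent ch c) = agent (L⁺.map expandComponent ch) c

    expand : Pattern → Pattern
    expand = map expandAgent

  dComp : ∀ {F} → Component F → List (Atomic F)
  dComp (atom x)      = x ∷ []
  dComp (struct _ xs) = xs

  deatom : ∀ {F} → MSet F → List (Atomic F)
  deatom = concatMap (λ A → concatMap dComp (toList (chain A)))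

  -- consistency of instantiations, given the aligned lists
  -- (pattern atomic, instantiated atomic) for both sides
  Consistent : List (Atomic PFeature × Atomic Feature)
             → List (Atomic PFeature × Atomic Feature) → Set
  Consistent []             _                = ⊤
  Consistent (_ ∷ _)        []               = ⊤
  Consistent ((p , g) ∷ xs) ((p′ , g′) ∷ ys) = (p ≡ p′ → g ≡ g′) × Consistent xs ys

  record Rule : Set where
    constructor _⇒_
    field
      lhs rhs : Pattern

  record Model : Set where
    field
      rules : List Rule
      σs    : StructSig
      σa    : AtomicSig
      M₀    : Multiset

  WFModel : Model → Set
  WFModel B = (∀ a → Nonempty (σa a))
            × All (λ r → WFPattern (Rule.lhs r) × WFPattern (Rule.rhs r)) rules
            × WFMultiset M₀
    where open Model B

  Step : Model → Multiset → Multiset → Set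
  Step B X Y =
    ∃[ r ] r ∈ₗ rules × (∃[ M ] ∃[ Mₗ ] ∃[ Mᵣ ]
      let Pl = expand σs (Rule.lhs r)
          Pr = expand σs (Rule.rhs r) in
      Inst σa Pl Mₗ × Inst σa Pr Mᵣ
      × Consistent (zip (deatom Pl) (deatom Mₗ)) (zip (deatom Pr) (deatom Mᵣ))
      × X ≈ₘ M ++ Mₗ × Y ≈ₘ M ++ Mᵣ)
    where open Model B

  -- membership of an infinite sequence of states in 𝔏(LTS_ε(B))
  InLTSε : Model → (ℕ → Multiset) → Set
  InLTSε B s = s 0 ≈ₘ Model.M₀ B
             × (∀ i → Step B (s i) (s (suc i))
                    ⊎ ((¬ (∃[ Y ] Step B (s i) Y)) × s (suc i) ≈ₘ s i))

  MMultiset : ℕ → Set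
  MMultiset n = Fin n → ℕ

  MRule : ℕ → Set
  MRule n = MMultiset n × MMultiset n

  Enabled : ∀ {n} → MRule n → MMultiset n → Set
  Enabled (pre , _) M = ∀ i → pre i ≤ M i

  applyRule : ∀ {n} → MRule n → MMultiset n → MMultiset n
  applyRule (pre , post) M i = (M i ∸ pre i) + post i

  record MRS : Set where
    field
      n       : ℕ
      species : Fin n → Agent Feature
      distinct : ∀ i j → species i ≈ag species j → i ≡ j
      rules   : List (MRule n)
      M₀      : MMultiset n

    -- identification of MRS multisets with BCSL multisets
    ⟦_⟧ : MMultiset n → Multiset
    ⟦ M ⟧ = concatMap (λ i → replicate (M i) (species i)) (allFin n)

    Run : (ℕ → MMultiset n) → Set
    Run ρ = (∀ j → ρ 0 j ≡ M₀ j)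
          × (∀ i → (∃[ μ ] μ ∈ₗ rules × Enabled μ (ρ i)
                           × (∀ j → ρ (suc i) j ≡ applyRule μ (ρ i) j))
                 ⊎ ((∀ μ → μ ∈ₗ rules → ¬ Enabled μ (ρ i))
                   × (∀ j → ρ (suc i) j ≡ ρ i j)))

    -- membership of a sequence of BCSL multisets in 𝔏(M)
    InL : (ℕ → Multiset) → Set
    InL s = ∃[ ρ ] Run ρ × (∀ i → ⟦ ρ i ⟧ ≈ₘ s i)

-- The species of the multiset rewriting system are the agents, up to the
-- congruence, that occur in M₀ or in one of the finitely many consistent
-- instantiations (Mₗ, Mᵣ) of an expanded rule; every BCSL rule gives one MRS
-- rule (#Mₗ, #Mᵣ) per such instantiation, where # counts agents per species.
-- All reachable multisets consist of species, and for such multisets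
-- X ≡ M + Mₗ holds for some M exactly when #Mₗ ≤ #X, in which case
-- #(M + Mᵣ) = #X ∸ #Mₗ + #Mᵣ.  So BCSL steps and MRS steps correspond under #,
-- deadlocks included, and the two sets of runs coincide.
module Submission where

open import Level using (0ℓ; _⊔_)
open import Data.Nat using (ℕ; zero; suc; _+_; _∸_; _≤_)
open import Data.Nat.Properties using (+-identityʳ; 0≢1+n; suc-injective; m+n∸n≡m; m∸n+n≡m; m≤n+m)
import Data.Fin as Fin
open Fin using (Fin)
import Data.Fin.Subset.Properties as Subset
open import Data.Maybe using (just; nothing)
import Data.Maybe.Properties as Maybe
open import Data.Product using (Σ; ∃-syntax; _×_; _,_; proj₁; proj₂)
open import Data.Sum using (_⊎_; inj₁; inj₂)
open import Data.Unit using (tt)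
open import Data.List
  using (List; []; _∷_; [_]; _++_; map; concatMap; filter; allFin; replicate; length; lookup; zip; deduplicate;
         cartesianProductWith; cartesianProduct)
open import Data.List.Properties using (filter-++; length-++; filter-accept; filter-all; filter-none; length-replicate)
open import Data.List.NonEmpty using (_∷_; toList)
open import Data.List.Relation.Binary.Pointwise using (Pointwise; []; _∷_)
open import Data.List.Relation.Unary.All as All using (All; []; _∷_)
import Data.List.Relation.Unary.All.Properties as All
open import Data.List.Relation.Unary.Any as Any using (Any; here; there)
import Data.List.Relation.Unary.Any.Properties as Any
open import Data.List.Relation.Unary.AllPairs using (_∷_)
import Data.List.Relation.Unary.Unique.Setoid as Unique
import Data.List.Relation.Unary.Unique.Propositional as Unique≡
open import Data.List.Relation.Unary.Unique.Propositional.Properties using (allFin⁺)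
open import Data.List.Relation.Unary.Unique.DecSetoid.Properties using (deduplicate-!)
open import Data.List.Membership.Propositional using (_∈_; _∉_; lose; find)
open import Data.List.Membership.Propositional.Properties
  using (∈-lookup; ∈-allFin; ∈-map⁺; ∈-map⁻; ∈-filter⁺; ∈-filter⁻; ∈-++⁺ˡ; ∈-++⁺ʳ; ∈-concatMap⁺; ∈-concatMap⁻;
         ∈-cartesianProductWith⁺; ∈-cartesianProductWith⁻; ∈-cartesianProduct⁺; ∈-cartesianProduct⁻)
import Data.List.Membership.Setoid.Properties as Membershipₛ
import Data.List.Membership.DecSetoid as DecMembership
import Data.List.Relation.Binary.Permutation.Propositional as Permutation≡
import Data.List.Relation.Binary.Permutation.Setoid as Permutation
import Data.List.Relation.Binary.Permutation.Setoid.Properties as Permutationₚ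
open import Function using (_∘_; id; _⇔_; mk⇔; Equivalence)
open import Relation.Binary.Bundles using (Setoid; DecSetoid)
open import Relation.Binary.Structures using (IsEquivalence)
open import Relation.Binary.Definitions using (Decidable; DecidableEquality)
open import Relation.Binary.PropositionalEquality
  using (_≡_; _≗_; refl; sym; trans; cong; cong₂; subst; module ≡-Reasoning)
import Relation.Binary.PropositionalEquality as ≡
open import Relation.Nullary using (¬_; yes; no; contradiction)
open import Relation.Nullary.Decidable using (Dec; _×-dec_; _→-dec_; map′)

open import Defs

module _ {a ℓ} (S : DecSetoid a ℓ) where
  open DecSetoid S using (setoid; _≈_) renaming (Carrier to A; refl to ≈-refl; sym to ≈-sym)
  open Permutation setoid using (_↭_; ↭-refl; ↭-sym; ↭-trans; ↭-transˡ-≋; ↭-transʳ-≋; prep)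
  open Permutationₚ setoid using (¬x∷xs↭[]; ∈-resp-↭; shift; drop-∷)
  open DecMembership S using (_∈?_)

  ↭-dec : Decidable _↭_
  ↭-dec []       []       = yes ↭-refl
  ↭-dec []       (y ∷ ys) = no (¬x∷xs↭[] ∘ ↭-sym)
  ↭-dec (x ∷ xs) ys with x ∈? ys
  ... | no x∉ys = no λ p → x∉ys (∈-resp-↭ p (here ≈-refl))
  ... | yes x∈ys
    with as , bs , w , x≈w , ys≋ ← Membershipₛ.∈-∃++ setoid x∈ys
    with ↭-dec xs (as ++ bs)
  ...   | yes p  = yes (↭-trans (prep x≈w p) (↭-sym (↭-transˡ-≋ ys≋ (shift ≈-refl as bs))))
  ...   | no ¬p  = no λ q → ¬p (drop-∷ (↭-trans (↭-transʳ-≋ q ys≋) (shift (≈-sym x≈w) as bs)))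

module _ {a ℓ} (S : Setoid a ℓ) where
  open Setoid S using (_≈_) renaming (sym to ≈-sym)
  open Unique S using (Unique)

  lookup-injective : ∀ {xs} → Unique xs → ∀ i j → lookup xs i ≈ lookup xs j → i ≡ j
  lookup-injective (_ ∷ _)      Fin.zero    Fin.zero    _ = refl
  lookup-injective (x≉ ∷ _)     Fin.zero    (Fin.suc j) e = contradiction e (All.lookup x≉ (∈-lookup j))
  lookup-injective (x≉ ∷ _)     (Fin.suc i) Fin.zero    e = contradiction (≈-sym e) (All.lookup x≉ (∈-lookup i))
  lookup-injective (_ ∷ unique) (Fin.suc i) (Fin.suc j) e = cong Fin.suc (lookup-injective unique i j e)

module _ {a ℓ} (S : DecSetoid a ℓ) where
  open DecSetoid S renaming (Carrier to A; refl to ≈-refl; sym to ≈-sym; trans to ≈-trans)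

  representatives : ∀ (xs : List A) → ∃[ n ] Σ (Fin n → A) λ rep →
                    (∀ i j → rep i ≈ rep j → i ≡ j) × (∀ {x} → x ∈ xs → ∃[ k ] x ≈ rep k)
  representatives xs =
    length ys , lookup ys , lookup-injective setoid (deduplicate-! S xs) , represented
    where
    ys = deduplicate _≟_ xs

    represented : ∀ {x} → x ∈ xs → ∃[ k ] x ≈ lookup ys k
    represented x∈xs = Any.index x∈ys , Any.lookup-index x∈ys
      where
      x∈ys = Any.deduplicate⁺ _≟_ (λ y≈z x≈y → ≈-trans x≈y (≈-sym y≈z)) (Any.map (λ { refl → ≈-refl }) x∈xs)

choices : {B : Set} → List (List B) → List (List B)
choices []         = [ [] ]
choices (bs ∷ bss) = cartesianProductWith _∷_ bs (choices bss)

Enumerates : {A B : Set} → (A → B → Set) → (A → List B) → Set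
Enumerates R enum = ∀ {a b} → R a b ⇔ b ∈ enum a

module _ {A B : Set} {R : A → B → Set} {enum : A → List B} (R-enum : Enumerates R enum) where

  choices-enumerates : Enumerates (Pointwise R) (choices ∘ map enum)
  choices-enumerates = mk⇔ to from
    where
    to : ∀ {xs ys} → Pointwise R xs ys → ys ∈ choices (map enum xs)
    to []       = here refl
    to (r ∷ rs) = ∈-cartesianProductWith⁺ _∷_ (Equivalence.to R-enum r) (to rs)

    from : ∀ {xs ys} → ys ∈ choices (map enum xs) → Pointwise R xs ys
    from {[]}     (here refl) = []
    from {x ∷ xs} p with b , bs , b∈ , bs∈ , refl ← ∈-cartesianProductWith⁻ _∷_ (enum x) _ p
      = Equivalence.from R-enum b∈ ∷ from bs∈

module Multiplicity {a ℓ} (S : DecSetoid a ℓ) {n : ℕ} (rep : Fin n → DecSetoid.Carrier S)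
                    (rep-injective : ∀ i j → DecSetoid._≈_ S (rep i) (rep j) → i ≡ j) where
  open DecSetoid S renaming (Carrier to A; refl to ≈-refl; sym to ≈-sym; trans to ≈-trans)
  open Permutation setoid using (_↭_; ↭-sym; ↭-trans; ↭-transˡ-≋; prep)
  open Permutationₚ setoid using (All-resp-↭; shift; filter⁺; xs↭ys⇒|xs|≡|ys|)
  open import Data.List.Membership.Setoid setoid using () renaming (_∈_ to _∈ₛ_)

  multiplicity : List A → Fin n → ℕ
  multiplicity xs k = length (filter (_≟ rep k) xs)

  Represented : A → Set ℓ
  Represented x = ∃[ k ] x ≈ rep k

  Covered : List A → Set (a ⊔ ℓ)
  Covered = All Represented

  spread : (Fin n → ℕ) → List (Fin n) → List A
  spread m = concatMap (λ i → replicate (m i) (rep i))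

  -- for species this is MRS.⟦_⟧ verbatim
  ⟦_⟧ : (Fin n → ℕ) → List A
  ⟦ m ⟧ = spread m (allFin n)

  module _ {k : Fin n} where

    multiplicity-++ : ∀ xs ys → multiplicity (xs ++ ys) k ≡ multiplicity xs k + multiplicity ys k
    multiplicity-++ xs ys = trans (cong length (filter-++ (_≟ rep k) xs ys)) (length-++ (filter (_≟ rep k) xs))

    multiplicity-resp-↭ : ∀ {xs ys} → xs ↭ ys → multiplicity xs k ≡ multiplicity ys k
    multiplicity-resp-↭ = xs↭ys⇒|xs|≡|ys| ∘ filter⁺ (_≟ rep k) (λ x≈y x≈k → ≈-trans (≈-sym x≈y) x≈k)

    multiplicity-∷-≈ : ∀ {x} xs → x ≈ rep k → multiplicity (x ∷ xs) k ≡ suc (multiplicity xs k)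
    multiplicity-∷-≈ xs x≈k = cong length (filter-accept (_≟ rep k) x≈k)

    multiplicity-∷-cancel : ∀ x xs ys → multiplicity (x ∷ xs) k ≡ multiplicity (x ∷ ys) k →
                            multiplicity xs k ≡ multiplicity ys k
    multiplicity-∷-cancel x xs ys with x ≟ rep k
    ... | yes _ = suc-injective
    ... | no  _ = id

    multiplicity-replicate-≈ : ∀ {x} m → x ≈ rep k → multiplicity (replicate m x) k ≡ m
    multiplicity-replicate-≈ m x≈k =
      trans (cong length (filter-all (_≟ rep k) (All.replicate⁺ m x≈k))) (length-replicate m)

    multiplicity-replicate-≉ : ∀ {x} m → ¬ x ≈ rep k → multiplicity (replicate m x) k ≡ 0
    multiplicity-replicate-≉ m x≉k = cong length (filter-none (_≟ rep k) (All.replicate⁺ m x≉k))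

    ∈-of-multiplicity≡suc : ∀ {x m} ys → x ≈ rep k → multiplicity ys k ≡ suc m → x ∈ₛ ys
    ∈-of-multiplicity≡suc (y ∷ ys) x≈k m≡suc with y ≟ rep k
    ... | yes y≈k = here (≈-trans x≈k (≈-sym y≈k))
    ... | no  _   = there (∈-of-multiplicity≡suc ys x≈k m≡suc)

    multiplicity-spread-∉ : ∀ m {is} → k ∉ is → multiplicity (spread m is) k ≡ 0
    multiplicity-spread-∉ m {[]}     _   = refl
    multiplicity-spread-∉ m {i ∷ is} k∉ =
      trans (multiplicity-++ (replicate (m i) (rep i)) _)
            (cong₂ _+_ (multiplicity-replicate-≉ (m i) (k∉ ∘ here ∘ sym ∘ rep-injective i k))
                       (multiplicity-spread-∉ m (k∉ ∘ there)))

    multiplicity-spread-∈ : ∀ m {is} → Unique≡.Unique is → k ∈ is → multiplicity (spread m is) k ≡ m k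
    multiplicity-spread-∈ m {i ∷ is} (i∉ ∷ _) (here refl) =
      trans (multiplicity-++ (replicate (m i) (rep i)) _)
            (trans (cong₂ _+_ (multiplicity-replicate-≈ (m i) ≈-refl)
                              (multiplicity-spread-∉ m (λ k∈ → All.lookup i∉ k∈ refl)))
                   (+-identityʳ (m k)))
    multiplicity-spread-∈ m {i ∷ is} (i∉ ∷ unique) (there k∈) =
      trans (multiplicity-++ (replicate (m i) (rep i)) _)
            (cong₂ _+_ (multiplicity-replicate-≉ (m i) (All.lookup i∉ k∈ ∘ rep-injective i k))
                       (multiplicity-spread-∈ m unique k∈))

  multiplicity-⟦⟧ : ∀ m k → multiplicity ⟦ m ⟧ k ≡ m k
  multiplicity-⟦⟧ m k = multiplicity-spread-∈ m (allFin⁺ n) (∈-allFin k)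

  ⟦⟧-covered : ∀ m → Covered ⟦ m ⟧
  ⟦⟧-covered m = All.concat⁺ (All.map⁺ {xs = allFin n} (All.tabulate λ {i} _ → All.replicate⁺ (m i) (i , ≈-refl)))

  Covered-resp-↭ : ∀ {xs ys} → xs ↭ ys → Covered xs → Covered ys
  Covered-resp-↭ = All-resp-↭ (λ { x≈y (k , x≈k) → k , ≈-trans (≈-sym x≈y) x≈k })

  ↭-from-multiplicity : ∀ {xs ys} → Covered xs → Covered ys →
                        (∀ k → multiplicity xs k ≡ multiplicity ys k) → xs ↭ ys
  ↭-from-multiplicity {[]}     {[]}     _ _ _ = Permutation.↭-refl setoid
  ↭-from-multiplicity {[]}     {y ∷ ys} _ ((k , y≈k) ∷ _) same =
    contradiction (trans (same k) (multiplicity-∷-≈ ys y≈k)) 0≢1+n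
  ↭-from-multiplicity {x ∷ xs} {ys} ((k , x≈k) ∷ xs-covered) ys-covered same
    with as , bs , w , x≈w , ys≋ ← Membershipₛ.∈-∃++ setoid
           (∈-of-multiplicity≡suc ys x≈k (trans (sym (same k)) (multiplicity-∷-≈ xs x≈k)))
    = ↭-trans (prep ≈-refl (↭-from-multiplicity xs-covered rest-covered same-rest)) (↭-sym ys↭x∷rest)
    where
    ys↭x∷rest : ys ↭ x ∷ as ++ bs
    ys↭x∷rest = ↭-transˡ-≋ ys≋ (shift (≈-sym x≈w) as bs)

    rest-covered : Covered (as ++ bs)
    rest-covered = All.tail (Covered-resp-↭ ys↭x∷rest ys-covered)

    same-rest : ∀ k → multiplicity xs k ≡ multiplicity (as ++ bs) k
    same-rest k = multiplicity-∷-cancel x xs (as ++ bs) (trans (same k) (multiplicity-resp-↭ ys↭x∷rest))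

  ⟦multiplicity⟧-↭ : ∀ {xs} → Covered xs → ⟦ multiplicity xs ⟧ ↭ xs
  ⟦multiplicity⟧-↭ xs-covered = ↭-from-multiplicity (⟦⟧-covered _) xs-covered (multiplicity-⟦⟧ _)

  ⟦⟧-↭⇒covered : ∀ {m xs} → ⟦ m ⟧ ↭ xs → Covered xs
  ⟦⟧-↭⇒covered {m} p = Covered-resp-↭ p (⟦⟧-covered m)

  ⟦⟧-↭⇒multiplicity : ∀ {m xs} → ⟦ m ⟧ ↭ xs → ∀ k → multiplicity xs k ≡ m k
  ⟦⟧-↭⇒multiplicity {m} p k = trans (sym (multiplicity-resp-↭ p)) (multiplicity-⟦⟧ m k)

module Congruence (V : Vocab) where
  open BCSL V

  atomic-≟ : ∀ {F} → DecidableEquality F → DecidableEquality (Atomic F)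
  atomic-≟ _≟F_ (atomic a f) (atomic b g) with a Fin.≟ b | f ≟F g
  ... | yes refl | yes refl = yes refl
  ... | no  a≢b  | _        = no λ { refl → a≢b refl }
  ... | _        | no  f≢g  = no λ { refl → f≢g refl }

  ≈c-isEquivalence : IsEquivalence (_≈c_ {Feature})
  ≈c-isEquivalence = record
    { refl = λ {c} → reflexive c ; sym = λ {c} {d} → symmetric c d ; trans = λ {c} {d} {e} → transitive c d e }
    where
    reflexive : ∀ c → c ≈c c
    reflexive (atom _)     = refl
    reflexive (struct _ _) = refl , Permutation≡.↭-refl

    symmetric : ∀ c d → c ≈c d → d ≈c c
    symmetric (atom _)     (atom _)     e          = sym e
    symmetric (struct _ _) (struct _ _) (refl , p) = refl , Permutation≡.↭-sym p

    transitive : ∀ c d e → c ≈c d → d ≈c e → c ≈c e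
    transitive (atom _)     (atom _)     (atom _)     e          e′         = trans e e′
    transitive (struct _ _) (struct _ _) (struct _ _) (refl , p) (refl , q) = refl , Permutation≡.↭-trans p q

  ≈c-dec : Decidable (_≈c_ {Feature})
  ≈c-dec (atom x)      (atom y)      = atomic-≟ Fin._≟_ x y
  ≈c-dec (atom _)      (struct _ _)  = no λ ()
  ≈c-dec (struct _ _)  (atom _)      = no λ ()
  ≈c-dec (struct s xs) (struct t ys) =
    s Fin.≟ t ×-dec map′ Permutation≡.↭ₛ⇒↭ Permutation≡.↭⇒↭ₛ (↭-dec (≡.decSetoid (atomic-≟ Fin._≟_)) xs ys)

  componentDecSetoid : DecSetoid 0ℓ 0ℓ
  componentDecSetoid = record
    { isDecEquivalence = record { isEquivalence = ≈c-isEquivalence ; _≟_ = ≈c-dec } }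

  agentDecSetoid : DecSetoid 0ℓ 0ℓ
  agentDecSetoid = record
    { Carrier = Agent Feature
    ; _≈_ = _≈ag_
    ; isDecEquivalence = record
      { isEquivalence = record
        { refl  = Chain.↭-refl , refl
        ; sym   = λ (p , e) → Chain.↭-sym p , sym e
        ; trans = λ (p , e) (q , e′) → Chain.↭-trans p q , trans e e′ }
      ; _≟_ = λ A B → ↭-dec componentDecSetoid (toList (chain A)) (toList (chain B))
                      ×-dec compartment A Fin.≟ compartment B } }
    where module Chain = Permutation (DecSetoid.setoid componentDecSetoid)

module Instantiation (V : Vocab) (σa : BCSL.AtomicSig V) where
  open BCSL V
  open Vocab V

  instantiateAtomic : Atomic PFeature → List (Atomic Feature)
  instantiateAtomic (atomic a (just f)) = [ atomic a f ]
  instantiateAtomic (atomic a nothing)  = map (atomic a) (filter (Subset._∈? σa a) (allFin nδ))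

  instantiateAtomic-enumerates : Enumerates (InstAtom σa) instantiateAtomic
  instantiateAtomic-enumerates = mk⇔ to from
    where
    to : ∀ {p g} → InstAtom σa p g → g ∈ instantiateAtomic p
    to {atomic a (just f)} (refl , inj₁ refl)       = here refl
    to {atomic a nothing}  (refl , inj₂ (refl , f∈)) = ∈-map⁺ (atomic a) (∈-filter⁺ (Subset._∈? σa a) (∈-allFin _) f∈)

    from : ∀ {p g} → g ∈ instantiateAtomic p → InstAtom σa p g
    from {atomic a (just f)} (here refl) = refl , inj₁ refl
    from {atomic a nothing}  g∈ with f , f∈ , refl ← ∈-map⁻ (atomic a) g∈ =
      refl , inj₂ (refl , proj₂ (∈-filter⁻ (Subset._∈? σa a) {xs = allFin nδ} f∈))

  instantiateComponent : Component PFeature → List (Component Feature)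
  instantiateComponent (atom p)      = map atom (instantiateAtomic p)
  instantiateComponent (struct s ps) = map (struct s) (choices (map instantiateAtomic ps))

  instantiateComponent-enumerates : Enumerates (InstComp σa) instantiateComponent
  instantiateComponent-enumerates = mk⇔ to from
    where
    atoms : Enumerates (Pointwise (InstAtom σa)) (choices ∘ map instantiateAtomic)
    atoms = choices-enumerates instantiateAtomic-enumerates

    to : ∀ {p g} → InstComp σa p g → g ∈ instantiateComponent p
    to {atom _}      {atom _}      i         = ∈-map⁺ atom (Equivalence.to instantiateAtomic-enumerates i)
    to {struct s _}  {struct _ _}  (refl , is) = ∈-map⁺ (struct s) (Equivalence.to atoms is)

    from : ∀ {p g} → g ∈ instantiateComponent p → InstComp σa p g
    from {atom _}     g∈ with _ , x∈ , refl ← ∈-map⁻ atom g∈ = Equivalence.from instantiateAtomic-enumerates x∈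
    from {struct s _} g∈ with _ , xs∈ , refl ← ∈-map⁻ (struct s) g∈ = refl , Equivalence.from atoms xs∈

  instantiateAgent : Agent PFeature → List (Agent Feature)
  instantiateAgent (agent (c ∷ cs) k) =
    cartesianProductWith (λ g gs → agent (g ∷ gs) k) (instantiateComponent c) (choices (map instantiateComponent cs))

  instantiateAgent-enumerates : Enumerates (InstAgent σa) instantiateAgent
  instantiateAgent-enumerates = mk⇔ to from
    where
    components : Enumerates (Pointwise (InstComp σa)) (choices ∘ map instantiateComponent)
    components = choices-enumerates instantiateComponent-enumerates

    to : ∀ {p g} → InstAgent σa p g → g ∈ instantiateAgent p
    to {agent (_ ∷ _) k} {agent (_ ∷ _) _} (i ∷ is , refl) =
      ∈-cartesianProductWith⁺ (λ g gs → agent (g ∷ gs) k) (Equivalence.to instantiateComponent-enumerates i) (Equivalence.to components is)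

    from : ∀ {p g} → g ∈ instantiateAgent p → InstAgent σa p g
    from {agent (c ∷ cs) k} g∈
      with _ , _ , x∈ , xs∈ , refl ← ∈-cartesianProductWith⁻ (λ g gs → agent (g ∷ gs) k) (instantiateComponent c) _ g∈
      = Equivalence.from instantiateComponent-enumerates x∈ ∷ Equivalence.from components xs∈ , refl

  instantiations : Pattern → List Multiset
  instantiations P = choices (map instantiateAgent P)

  instantiations-enumerates : Enumerates (Inst σa) instantiations
  instantiations-enumerates = choices-enumerates instantiateAgent-enumerates

module RuleInstances (V : Vocab) (B : BCSL.Model V) where
  open BCSL V
  open Model B
  open Instantiation V σa
  open Congruence V

  lhsPattern rhsPattern : Rule → Pattern
  lhsPattern r = expand σs (Rule.lhs r)
  rhsPattern r = expand σs (Rule.rhs r)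

  consistent? : ∀ xs ys → Dec (Consistent xs ys)
  consistent? []             _                = yes tt
  consistent? (_ ∷ _)        []               = yes tt
  consistent? ((p , g) ∷ xs) ((p′ , g′) ∷ ys) =
    (atomic-≟ (Maybe.≡-dec Fin._≟_) p p′ →-dec atomic-≟ Fin._≟_ g g′) ×-dec consistent? xs ys

  ConsistentInstance : Rule → Multiset × Multiset → Set
  ConsistentInstance r (Mₗ , Mᵣ) =
    Consistent (zip (deatom (lhsPattern r)) (deatom Mₗ)) (zip (deatom (rhsPattern r)) (deatom Mᵣ))

  consistentInstance? : ∀ r q → Dec (ConsistentInstance r q)
  consistentInstance? r _ = consistent? _ _

  IsInstance : Rule → Multiset × Multiset → Set
  IsInstance r (Mₗ , Mᵣ) = Inst σa (lhsPattern r) Mₗ × Inst σa (rhsPattern r) Mᵣ × ConsistentInstance r (Mₗ , Mᵣ)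

  instances : Rule → List (Multiset × Multiset)
  instances r = filter (consistentInstance? r)
    (cartesianProduct (instantiations (lhsPattern r)) (instantiations (rhsPattern r)))

  instances-enumerates : ∀ r {q} → IsInstance r q ⇔ q ∈ instances r
  instances-enumerates r = mk⇔ to from
    where
    to : ∀ {q} → IsInstance r q → q ∈ instances r
    to (iₗ , iᵣ , c) = ∈-filter⁺ (consistentInstance? r)
      (∈-cartesianProduct⁺ (Equivalence.to instantiations-enumerates iₗ) (Equivalence.to instantiations-enumerates iᵣ)) c

    from : ∀ {q} → q ∈ instances r → IsInstance r q
    from q∈ with q∈× , c ← ∈-filter⁻ (consistentInstance? r) q∈
            with ∈ₗ , ∈ᵣ ← ∈-cartesianProduct⁻ _ _ q∈×
      = Equivalence.from instantiations-enumerates ∈ₗ , Equivalence.from instantiations-enumerates ∈ᵣ , c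

  universe : List (Agent Feature)
  universe = M₀ ++ concatMap (λ r → concatMap (λ (Mₗ , Mᵣ) → Mₗ ++ Mᵣ) (instances r)) rules

-- The species are parameters rather than computed from the universe, so that
-- type checking never unfolds the deduplication of the universe.
module Simulation (V : Vocab) (B : BCSL.Model V) {n : ℕ} (species : Fin n → BCSL.Agent V (BCSL.Feature V))
                  (species-injective : ∀ i j → BCSL._≈ag_ V (species i) (species j) → i ≡ j)
                  (universe-represented : ∀ {x} → x ∈ RuleInstances.universe V B → ∃[ k ] BCSL._≈ag_ V x (species k))
                  where
  open BCSL V
  open Model B
  open Congruence V
  open RuleInstances V B
  open Multiplicity agentDecSetoid species species-injective public
  open Permutation (DecSetoid.setoid agentDecSetoid) using (↭-sym)

  M₀-covered : Covered M₀
  M₀-covered = All.tabulate (universe-represented ∘ ∈-++⁺ˡ)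

  instance-covered : ∀ {r Mₗ Mᵣ} → r ∈ rules → (Mₗ , Mᵣ) ∈ instances r → Covered Mₗ × Covered Mᵣ
  instance-covered {r} {Mₗ} r∈ q∈ = All.tabulate (represented ∘ ∈-++⁺ˡ) , All.tabulate (represented ∘ ∈-++⁺ʳ Mₗ)
    where
    represented : ∀ {x} → x ∈ Mₗ ++ _ → Represented x
    represented x∈ = universe-represented (∈-++⁺ʳ M₀ (∈-concatMap⁺ _ (lose r∈ (∈-concatMap⁺ _ (lose q∈ x∈)))))

  toMRule : Multiset × Multiset → MRule n
  toMRule (Mₗ , Mᵣ) = multiplicity Mₗ , multiplicity Mᵣ

  mrsRules : List (MRule n)
  mrsRules = concatMap (λ r → map toMRule (instances r)) rules

  ∈-mrsRules⁺ : ∀ {r q} → r ∈ rules → IsInstance r q → toMRule q ∈ mrsRules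
  ∈-mrsRules⁺ {r} r∈ i = ∈-concatMap⁺ _ (lose r∈ (∈-map⁺ toMRule (Equivalence.to (instances-enumerates r) i)))

  ∈-mrsRules⁻ : ∀ {μ} → μ ∈ mrsRules → ∃[ r ] ∃[ q ] r ∈ rules × q ∈ instances r × μ ≡ toMRule q
  ∈-mrsRules⁻ μ∈
    with r , r∈ , μ∈′ ← find (∈-concatMap⁻ _ {xs = rules} μ∈)
    with q , q∈ , refl ← ∈-map⁻ toMRule μ∈′
    = r , q , r∈ , q∈ , refl

  system : MRS
  system = record
    { n = n ; species = species ; distinct = species-injective
    ; rules = mrsRules ; M₀ = multiplicity M₀ }

  MRSStep : (m m′ : MMultiset n) → Set
  MRSStep m m′ = ∃[ μ ] μ ∈ mrsRules × Enabled μ m × (∀ j → m′ j ≡ applyRule μ m j)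

  MRSStep-resp : ∀ {m₁ m₂ m₁′ m₂′} → m₁ ≗ m₂ → m₁′ ≗ m₂′ → MRSStep m₁ m₁′ → MRSStep m₂ m₂′
  MRSStep-resp m₁≗m₂ m₁′≗m₂′ ((pre , post) , μ∈ , enabled , applied) =
    (pre , post) , μ∈ , (λ j → subst (pre j ≤_) (m₁≗m₂ j) (enabled j)) ,
    λ j → trans (sym (m₁′≗m₂′ j)) (trans (applied j) (cong (λ x → x ∸ pre j + post j) (m₁≗m₂ j)))

  step⇒MRSStep : ∀ {X Y} → Step B X Y → MRSStep (multiplicity X) (multiplicity Y)
  step⇒MRSStep {X} {Y} (r , r∈ , M , Mₗ , Mᵣ , iₗ , iᵣ , c , X↭ , Y↭) =
    toMRule (Mₗ , Mᵣ) , ∈-mrsRules⁺ r∈ (iₗ , iᵣ , c) , enabled , applied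
    where
    X-split : ∀ j → multiplicity X j ≡ multiplicity M j + multiplicity Mₗ j
    X-split j = trans (multiplicity-resp-↭ X↭) (multiplicity-++ M Mₗ)

    enabled : ∀ j → multiplicity Mₗ j ≤ multiplicity X j
    enabled j = subst (multiplicity Mₗ j ≤_) (sym (X-split j)) (m≤n+m _ _)

    leftover : ∀ j → multiplicity X j ∸ multiplicity Mₗ j ≡ multiplicity M j
    leftover j = trans (cong (_∸ multiplicity Mₗ j) (X-split j)) (m+n∸n≡m (multiplicity M j) (multiplicity Mₗ j))

    applied : ∀ j → multiplicity Y j ≡ multiplicity X j ∸ multiplicity Mₗ j + multiplicity Mᵣ j
    applied j = begin
      multiplicity Y j                                          ≡⟨ multiplicity-resp-↭ Y↭ ⟩
      multiplicity (M ++ Mᵣ) j                                  ≡⟨ multiplicity-++ M Mᵣ ⟩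
      multiplicity M j + multiplicity Mᵣ j                      ≡⟨ cong (_+ multiplicity Mᵣ j) (leftover j) ⟨
      multiplicity X j ∸ multiplicity Mₗ j + multiplicity Mᵣ j  ∎
      where open ≡-Reasoning

  step-covered : ∀ {X Y} → Covered X → Step B X Y → Covered Y
  step-covered X-covered (r , r∈ , M , Mₗ , Mᵣ , iₗ , iᵣ , c , X↭ , Y↭) =
    Covered-resp-↭ (↭-sym Y↭) (All.++⁺ (All.++⁻ˡ M (Covered-resp-↭ X↭ X-covered)) Mᵣ-covered)
    where
    Mᵣ-covered : Covered Mᵣ
    Mᵣ-covered = proj₂ (instance-covered r∈ (Equivalence.to (instances-enumerates r) (iₗ , iᵣ , c)))

  MRSStep⇒step : ∀ {X Y} → Covered X → Covered Y → MRSStep (multiplicity X) (multiplicity Y) → Step B X Y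
  MRSStep⇒step {X} {Y} X-covered Y-covered (μ , μ∈ , enabled , applied)
    with r , (Mₗ , Mᵣ) , r∈ , q∈ , refl ← ∈-mrsRules⁻ μ∈
    = let iₗ , iᵣ , c = Equivalence.from (instances-enumerates r) q∈ in
      r , r∈ , M , Mₗ , Mᵣ , iₗ , iᵣ , c ,
      ↭-from-multiplicity X-covered (All.++⁺ (⟦⟧-covered rest) Mₗ-covered) X-split ,
      ↭-from-multiplicity Y-covered (All.++⁺ (⟦⟧-covered rest) Mᵣ-covered) Y-split
    where
    rest : MMultiset n
    rest j = multiplicity X j ∸ multiplicity Mₗ j

    -- the context of the BCSL step: what is left of X once Mₗ is consumed
    M : Multiset
    M = ⟦ rest ⟧

    Mₗ-covered : Covered Mₗ
    Mₗ-covered = proj₁ (instance-covered r∈ q∈)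

    Mᵣ-covered : Covered Mᵣ
    Mᵣ-covered = proj₂ (instance-covered r∈ q∈)

    multiplicity-M++ : ∀ N j → multiplicity (M ++ N) j ≡ rest j + multiplicity N j
    multiplicity-M++ N j = trans (multiplicity-++ M N) (cong (_+ multiplicity N j) (multiplicity-⟦⟧ rest j))

    X-split : ∀ j → multiplicity X j ≡ multiplicity (M ++ Mₗ) j
    X-split j = trans (sym (m∸n+n≡m (enabled j))) (sym (multiplicity-M++ Mₗ j))

    Y-split : ∀ j → multiplicity Y j ≡ multiplicity (M ++ Mᵣ) j
    Y-split j = trans (applied j) (sym (multiplicity-M++ Mᵣ j))

  enabled⇒step : ∀ {X μ} → Covered X → μ ∈ mrsRules → Enabled μ (multiplicity X) → ∃[ Y ] Step B X Y
  enabled⇒step {X} {μ} X-covered μ∈ enabled =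
    ⟦ applyRule μ (multiplicity X) ⟧ ,
    MRSStep⇒step X-covered (⟦⟧-covered _) (μ , μ∈ , enabled , multiplicity-⟦⟧ _)

  Deadlocked : MMultiset n → Set
  Deadlocked m = ∀ μ → μ ∈ mrsRules → ¬ Enabled μ m

  InLTSε⇒InL : ∀ s → InLTSε B s → MRS.InL system s
  InLTSε⇒InL s (s₀↭M₀ , steps) = ρ , ((λ _ → multiplicity-resp-↭ s₀↭M₀) , run) , ⟦multiplicity⟧-↭ ∘ covered
    where
    ρ : ℕ → MMultiset n
    ρ i = multiplicity (s i)

    covered : ∀ i → Covered (s i)
    covered zero    = Covered-resp-↭ (↭-sym s₀↭M₀) M₀-covered
    covered (suc i) with steps i
    ... | inj₁ step          = step-covered (covered i) step
    ... | inj₂ (_ , s′↭s)    = Covered-resp-↭ (↭-sym s′↭s) (covered i)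

    run : ∀ i → MRSStep (ρ i) (ρ (suc i)) ⊎ (Deadlocked (ρ i) × ρ (suc i) ≗ ρ i)
    run i with steps i
    ... | inj₁ step          = inj₁ (step⇒MRSStep step)
    ... | inj₂ (stuck , s′↭s) =
      inj₂ ((λ μ μ∈ enabled → stuck (enabled⇒step (covered i) μ∈ enabled)) , λ _ → multiplicity-resp-↭ s′↭s)

  InL⇒InLTSε : ∀ s → MRS.InL system s → InLTSε B s
  InL⇒InLTSε s (ρ , (ρ₀ , run) , ⟦ρ⟧↭s) =
    ↭-from-multiplicity (covered 0) M₀-covered (λ j → trans (counts 0 j) (ρ₀ j)) , steps
    where
    covered : ∀ i → Covered (s i)
    covered i = ⟦⟧-↭⇒covered (⟦ρ⟧↭s i)

    counts : ∀ i → multiplicity (s i) ≗ ρ i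
    counts i = ⟦⟧-↭⇒multiplicity (⟦ρ⟧↭s i)

    steps : ∀ i → Step B (s i) (s (suc i)) ⊎ (¬ (∃[ Y ] Step B (s i) Y) × s (suc i) ≈ₘ s i)
    steps i with run i
    ... | inj₁ mstep = inj₁ (MRSStep⇒step (covered i) (covered (suc i))
                              (MRSStep-resp (sym ∘ counts i) (sym ∘ counts (suc i)) mstep))
    ... | inj₂ (deadlocked , ρ′≗ρ) = inj₂ (stuck , ↭-from-multiplicity (covered (suc i)) (covered i)
                                             (λ j → trans (counts (suc i) j) (trans (ρ′≗ρ j) (sym (counts i j)))))
      where
      stuck : ¬ (∃[ Y ] Step B (s i) Y)
      stuck (_ , step) =
        let μ , μ∈ , enabled , _ = MRSStep-resp (counts i) (λ _ → refl) (step⇒MRSStep step) in deadlocked μ μ∈ enabled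

theorem1 : (V : Vocab) (B : BCSL.Model V) → BCSL.WFModel V B →
    let open BCSL V in
    Σ MRS λ 𝓜 →
      (MRS.⟦_⟧ 𝓜 (MRS.M₀ 𝓜) ≈ₘ Model.M₀ B)
      × ((s : ℕ → Multiset) → (InLTSε B s ⇔ MRS.InL 𝓜 s))
theorem1 V B _ =
  let n , species , species-injective , universe-represented =
        representatives (Congruence.agentDecSetoid V) (RuleInstances.universe V B)
      open Simulation V B species species-injective universe-represented
  in system , ⟦multiplicity⟧-↭ M₀-covered , λ s → mk⇔ (InLTSε⇒InL s) (InL⇒InLTSε s)
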